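{- Let $\Gamma$ be a finite connected simple graph with a perfect matching $\mathcal{M} = \{e_i = \{\alpha_i,\beta_i\} : 1 \le i \le m\}$, $m \ge 2$, such that $M := \operatorname{Aut}(\Gamma)_{\mathcal{M}}$, the setwise stabilizer of $\mathcal{M}$ in $\operatorname{Aut}(\Gamma)$, acts $2$-transitively on the edges of $\mathcal{M}$. Assume the induced subgraph $\Gamma[\alpha_1,\beta_1,\alpha_2,\beta_2]$ is isomorphic to the $4$-cycle $C_4$. Let $x$ be the permutation of $V(\Gamma)$ with $\alpha_i^x = \beta_i$ and $\beta_i^x = \alpha_i$ for all $i$. Then $x$ lies in the center $Z(M)$ of $M$.
   Context: $\Gamma[X]$ denotes the subgraph induced on the vertex set $X$. -}

module Defs where

open import Data.Nat using (ℕ; zero; suc)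
open import Data.Fin using (Fin; zero; suc)
open import Data.Bool using (Bool; true; false)
open import Data.Sum using (_⊎_; inj₁; inj₂; [_,_])
open import Data.Product using (Σ; ∃; _×_; _,_; proj₁)
open import Data.List using (List; []; _∷_)
open import Data.List.Membership.Propositional using (_∈_)
open import Data.Fin.Permutation using (Permutation′; _⟨$⟩ʳ_)
open import Function.Bundles using (_↔_; Inverse)
open import Function.Definitions using (Bijective)
open import Relation.Binary.PropositionalEquality using (_≡_; _≢_)

record SimpleGraph (n : ℕ) : Set where
  field
    Adj   : Fin n → Fin n → Bool
    sym   : ∀ u v → Adj u v ≡ Adj v u
    irrefl : ∀ v → Adj v v ≡ false
open SimpleGraph public

data Walk {n : ℕ} (Γ : SimpleGraph n) : Fin n → Fin n → Set where
  here : ∀ {v} → Walk Γ v v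
  step : ∀ {u v w} → Adj Γ u v ≡ true → Walk Γ v w → Walk Γ u w

Connected : ∀ {n} → SimpleGraph n → Set
Connected {n} Γ = (u v : Fin n) → Walk Γ u v

IsAut : ∀ {n} → SimpleGraph n → Permutation′ n → Set
IsAut {n} Γ g = (u v : Fin n) → Adj Γ (g ⟨$⟩ʳ u) (g ⟨$⟩ʳ v) ≡ Adj Γ u v

-- Perfect matching {e_i = {α i, β i} : i ∈ Fin m}: each e_i is an edge and
-- every vertex lies in exactly one e_i, in exactly one position.
IsPerfectMatching : ∀ {n m} → SimpleGraph n → (α β : Fin m → Fin n) → Set
IsPerfectMatching {n} {m} Γ α β =
  ((i : Fin m) → Adj Γ (α i) (β i) ≡ true) × Bijective _≡_ _≡_ [ α , β ]

PairEq : ∀ {n} → (a b c d : Fin n) → Set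
PairEq a b c d = (a ≡ c × b ≡ d) ⊎ (a ≡ d × b ≡ c)

MapsEdge : ∀ {n m} → (α β : Fin m → Fin n) → Permutation′ n → Fin m → Fin m → Set
MapsEdge α β g i j = PairEq (g ⟨$⟩ʳ α i) (g ⟨$⟩ʳ β i) (α j) (β j)

InStab : ∀ {n m} → SimpleGraph n → (α β : Fin m → Fin n) → Permutation′ n → Set
InStab {n} {m} Γ α β g =
  IsAut Γ g
  × ((i : Fin m) → ∃ λ j → MapsEdge α β g i j)
  × ((j : Fin m) → ∃ λ i → MapsEdge α β g i j)

TwoTransitiveOnEdges : ∀ {n m} → SimpleGraph n → (α β : Fin m → Fin n) → Set
TwoTransitiveOnEdges {n} {m} Γ α β =
  (i j k l : Fin m) → i ≢ j → k ≢ l →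
  Σ (Permutation′ n) λ g → InStab Γ α β g × MapsEdge α β g i k × MapsEdge α β g j l

C4Adj : Fin 4 → Fin 4 → Bool
C4Adj zero (suc zero) = true
C4Adj (suc zero) zero = true
C4Adj (suc zero) (suc (suc zero)) = true
C4Adj (suc (suc zero)) (suc zero) = true
C4Adj (suc (suc zero)) (suc (suc (suc zero))) = true
C4Adj (suc (suc (suc zero))) (suc (suc zero)) = true
C4Adj (suc (suc (suc zero))) zero = true
C4Adj zero (suc (suc (suc zero))) = true
C4Adj _ _ = false

InducedIsoC4 : ∀ {n} → SimpleGraph n → List (Fin n) → Set
InducedIsoC4 {n} Γ X =
  Σ (Fin 4 ↔ Σ (Fin n) (λ v → v ∈ X)) λ f →
    (a b : Fin 4) →
      Adj Γ (proj₁ (Inverse.to f a)) (proj₁ (Inverse.to f b)) ≡ C4Adj a b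

-- C₄ is the complete bipartite graph K₂,₂, so in it the adjacency between two
-- disjoint edges is unchanged when both edges are flipped. Hence swapping the
-- ends of e₁ and of e₂ preserves adjacency between them; 2-transitivity of M
-- carries this to every pair of matching edges, so x is an automorphism. It
-- lies in M as it fixes each eᵢ, and it is central because any g ∈ M maps each
-- matching edge onto a matching edge, on whose ends x again acts as the swap.
module Submission where

open import Defs hiding (sym)
open import Data.Nat using (ℕ; suc)
open import Data.Fin using (Fin; zero; suc)
open import Data.Fin.Properties using (_≟_)
open import Data.Bool using (Bool; true; false; not; _xor_)
open import Data.Bool.Properties using (not-distribˡ-xor; not-distribʳ-xor; not-involutive)
open import Data.List using (_∷_; [])
open import Data.List.Membership.Propositional using (_∈_)
open import Data.List.Relation.Unary.Any using (here; there)
open import Data.Product using (_×_; _,_; proj₁; proj₂; ∃)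
open import Data.Sum using (inj₁; inj₂; [_,_]; swap)
open import Relation.Nullary using (yes; no)
open import Data.Fin.Permutation using (Permutation′; _⟨$⟩ʳ_)
open import Function.Bundles using (Inverse)
open import Function.Consequences.Propositional using (surjective⇒strictlySurjective)
open import Relation.Binary.PropositionalEquality
  using (_≡_; _≢_; refl; sym; trans; cong; cong₂; module ≡-Reasoning)

SwapInvariant : ∀ {n} → SimpleGraph n → (a b c d : Fin n) → Set
SwapInvariant Γ a b c d = (Adj Γ a c ≡ Adj Γ b d) × (Adj Γ a d ≡ Adj Γ b c)

C4Side : Fin 4 → Bool
C4Side zero                   = false
C4Side (suc zero)             = true
C4Side (suc (suc zero))       = false
C4Side (suc (suc (suc zero))) = true

C4Adj≡xor : ∀ a b → C4Adj a b ≡ C4Side a xor C4Side b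
C4Adj≡xor zero                   zero                   = refl
C4Adj≡xor zero                   (suc zero)             = refl
C4Adj≡xor zero                   (suc (suc zero))       = refl
C4Adj≡xor zero                   (suc (suc (suc zero))) = refl
C4Adj≡xor (suc zero)             zero                   = refl
C4Adj≡xor (suc zero)             (suc zero)             = refl
C4Adj≡xor (suc zero)             (suc (suc zero))       = refl
C4Adj≡xor (suc zero)             (suc (suc (suc zero))) = refl
C4Adj≡xor (suc (suc zero))       zero                   = refl
C4Adj≡xor (suc (suc zero))       (suc zero)             = refl
C4Adj≡xor (suc (suc zero))       (suc (suc zero))       = refl
C4Adj≡xor (suc (suc zero))       (suc (suc (suc zero))) = refl
C4Adj≡xor (suc (suc (suc zero))) zero                   = refl
C4Adj≡xor (suc (suc (suc zero))) (suc zero)             = refl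
C4Adj≡xor (suc (suc (suc zero))) (suc (suc zero))       = refl
C4Adj≡xor (suc (suc (suc zero))) (suc (suc (suc zero))) = refl

xor≡true⇒≡not : ∀ a b → a xor b ≡ true → b ≡ not a
xor≡true⇒≡not false b eq = eq
xor≡true⇒≡not true  b eq = trans (sym (not-involutive b)) (cong not eq)

xor-swap : ∀ a b c d → a xor b ≡ true → c xor d ≡ true →
           (a xor c ≡ b xor d) × (a xor d ≡ b xor c)
xor-swap a b c d ab cd rewrite xor≡true⇒≡not a b ab | xor≡true⇒≡not c d cd =
  flip-both a c , trans (sym (not-distribʳ-xor a c)) (not-distribˡ-xor a c)
  where
  open ≡-Reasoning
  flip-both : ∀ a c → a xor c ≡ not a xor not c
  flip-both a c = begin
    a xor c             ≡⟨ sym (not-involutive (a xor c)) ⟩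
    not (not (a xor c)) ≡⟨ cong not (not-distribˡ-xor a c) ⟩
    not (not a xor c)   ≡⟨ not-distribʳ-xor (not a) c ⟩
    not a xor not c     ∎

C4-swapInvariant : ∀ p q r s → C4Adj p q ≡ true → C4Adj r s ≡ true →
                   (C4Adj p r ≡ C4Adj q s) × (C4Adj p s ≡ C4Adj q r)
C4-swapInvariant p q r s pq rs
  rewrite C4Adj≡xor p r | C4Adj≡xor q s | C4Adj≡xor p s | C4Adj≡xor q r =
  xor-swap (C4Side p) (C4Side q) (C4Side r) (C4Side s)
    (trans (sym (C4Adj≡xor p q)) pq) (trans (sym (C4Adj≡xor r s)) rs)

module _ {n : ℕ} (Γ : SimpleGraph n) where

  C4Index : ∀ {X} → InducedIsoC4 Γ X → ∀ {u} → u ∈ X → Fin 4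
  C4Index (f , _) {u} u∈X = Inverse.from f (u , u∈X)

  induced-C4-adj : ∀ {X} (iso : InducedIsoC4 Γ X) {u v} (u∈X : u ∈ X) (v∈X : v ∈ X) →
    Adj Γ u v ≡ C4Adj (C4Index iso u∈X) (C4Index iso v∈X)
  induced-C4-adj (f , adj) {u} {v} u∈X v∈X =
    trans (cong₂ (Adj Γ) (sym (to∘from (u , u∈X))) (sym (to∘from (v , v∈X)))) (adj _ _)
    where
    to∘from : ∀ w → proj₁ (Inverse.to f (Inverse.from f w)) ≡ proj₁ w
    to∘from w = cong proj₁ (Inverse.strictlyInverseˡ f w)

  induced-C4-swapInvariant : ∀ {X} → InducedIsoC4 Γ X → ∀ {a b c d} →
    a ∈ X → b ∈ X → c ∈ X → d ∈ X →
    Adj Γ a b ≡ true → Adj Γ c d ≡ true → SwapInvariant Γ a b c d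
  induced-C4-swapInvariant iso a∈X b∈X c∈X d∈X ab cd
    rewrite induced-C4-adj iso a∈X c∈X | induced-C4-adj iso b∈X d∈X
          | induced-C4-adj iso a∈X d∈X | induced-C4-adj iso b∈X c∈X =
    C4-swapInvariant _ _ _ _
      (trans (sym (induced-C4-adj iso a∈X b∈X)) ab)
      (trans (sym (induced-C4-adj iso c∈X d∈X)) cd)

  swapInvariant-refl : ∀ a b → SwapInvariant Γ a b a b
  swapInvariant-refl a b = trans (irrefl Γ a) (sym (irrefl Γ b)) , SimpleGraph.sym Γ a b

  swapInvariant-aut : ∀ g → IsAut Γ g → ∀ {a b c d} → SwapInvariant Γ a b c d →
    SwapInvariant Γ (g ⟨$⟩ʳ a) (g ⟨$⟩ʳ b) (g ⟨$⟩ʳ c) (g ⟨$⟩ʳ d)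
  swapInvariant-aut g aut (ac , ad) =
    trans (aut _ _) (trans ac (sym (aut _ _))) , trans (aut _ _) (trans ad (sym (aut _ _)))

  swapInvariant-pairEq : ∀ {a b c d a′ b′ c′ d′} → PairEq a b a′ b′ → PairEq c d c′ d′ →
    SwapInvariant Γ a b c d → SwapInvariant Γ a′ b′ c′ d′
  swapInvariant-pairEq (inj₁ (refl , refl)) (inj₁ (refl , refl)) (ac , ad) = ac , ad
  swapInvariant-pairEq (inj₁ (refl , refl)) (inj₂ (refl , refl)) (ac , ad) = ad , ac
  swapInvariant-pairEq (inj₂ (refl , refl)) (inj₁ (refl , refl)) (ac , ad) = sym ad , sym ac
  swapInvariant-pairEq (inj₂ (refl , refl)) (inj₂ (refl , refl)) (ac , ad) = sym ac , sym ad

pairEq-swap-commutes : ∀ {n} {g x : Fin n → Fin n} {a b c d} →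
  PairEq (g a) (g b) c d → x c ≡ d → x d ≡ c → (g b ≡ x (g a)) × (g a ≡ x (g b))
pairEq-swap-commutes (inj₁ (refl , refl)) xc xd = sym xc , sym xd
pairEq-swap-commutes (inj₂ (refl , refl)) xc xd = sym xd , sym xc

module _ {n m : ℕ} (Γ : SimpleGraph n) (α β : Fin m → Fin n) where

  matched-vertex : IsPerfectMatching Γ α β → ∀ v → ∃ λ t → [ α , β ] t ≡ v
  matched-vertex (_ , _ , surj) = surjective⇒strictlySurjective surj

  SwapsMatching : Permutation′ n → Set
  SwapsMatching x = (i : Fin m) → (x ⟨$⟩ʳ α i ≡ β i) × (x ⟨$⟩ʳ β i ≡ α i)

  swapsMatching-tag : ∀ x → SwapsMatching x → ∀ t → x ⟨$⟩ʳ [ α , β ] t ≡ [ α , β ] (swap t)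
  swapsMatching-tag x hx (inj₁ i) = proj₁ (hx i)
  swapsMatching-tag x hx (inj₂ i) = proj₂ (hx i)

  swapsMatching-aut : IsPerfectMatching Γ α β →
    (∀ i j → SwapInvariant Γ (α i) (β i) (α j) (β j)) →
    ∀ x → SwapsMatching x → IsAut Γ x
  swapsMatching-aut pm inv x hx u v
    with matched-vertex pm u | matched-vertex pm v
  ... | s , refl | t , refl =
    trans (cong₂ (Adj Γ) (swapsMatching-tag x hx s) (swapsMatching-tag x hx t)) (swapped s t)
    where
    swapped : ∀ s t → Adj Γ ([ α , β ] (swap s)) ([ α , β ] (swap t))
                    ≡ Adj Γ ([ α , β ] s) ([ α , β ] t)
    swapped (inj₁ i) (inj₁ j) = sym (proj₁ (inv i j))
    swapped (inj₁ i) (inj₂ j) = sym (proj₂ (inv i j))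
    swapped (inj₂ i) (inj₁ j) = proj₂ (inv i j)
    swapped (inj₂ i) (inj₂ j) = proj₁ (inv i j)

  swapsMatching-inStab : IsPerfectMatching Γ α β →
    (∀ i j → SwapInvariant Γ (α i) (β i) (α j) (β j)) →
    ∀ x → SwapsMatching x → InStab Γ α β x
  swapsMatching-inStab pm inv x hx =
    swapsMatching-aut pm inv x hx , (λ i → i , fixes i) , (λ i → i , fixes i)
    where
    fixes : ∀ i → MapsEdge α β x i i
    fixes i = inj₂ (hx i)

  twoTransitive-swapInvariant : TwoTransitiveOnEdges Γ α β → ∀ {i₀ j₀} → i₀ ≢ j₀ →
    SwapInvariant Γ (α i₀) (β i₀) (α j₀) (β j₀) →
    ∀ i j → SwapInvariant Γ (α i) (β i) (α j) (β j)
  twoTransitive-swapInvariant tt i₀≢j₀ base i j with i ≟ j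
  ... | yes refl = swapInvariant-refl Γ (α i) (β i)
  ... | no i≢j with tt _ _ i j i₀≢j₀ i≢j
  ...   | g , (aut , _) , mapsᵢ , mapsⱼ =
    swapInvariant-pairEq Γ mapsᵢ mapsⱼ (swapInvariant-aut Γ g aut base)

  inStab-swapsMatching-commute : ∀ x → SwapsMatching x → ∀ g → InStab Γ α β g → ∀ i →
    (g ⟨$⟩ʳ β i ≡ x ⟨$⟩ʳ (g ⟨$⟩ʳ α i)) × (g ⟨$⟩ʳ α i ≡ x ⟨$⟩ʳ (g ⟨$⟩ʳ β i))
  inStab-swapsMatching-commute x hx g (_ , maps , _) i with maps i
  ... | j , mapsᵢ =
    pairEq-swap-commutes {g = g ⟨$⟩ʳ_} {x = x ⟨$⟩ʳ_} mapsᵢ (proj₁ (hx j)) (proj₂ (hx j))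

  swapsMatching-central : IsPerfectMatching Γ α β → ∀ x → SwapsMatching x →
    ∀ g → InStab Γ α β g → ∀ v → g ⟨$⟩ʳ (x ⟨$⟩ʳ v) ≡ x ⟨$⟩ʳ (g ⟨$⟩ʳ v)
  swapsMatching-central pm x hx g g∈M v with matched-vertex pm v
  ... | inj₁ i , refl =
    trans (cong (g ⟨$⟩ʳ_) (proj₁ (hx i))) (proj₁ (inStab-swapsMatching-commute x hx g g∈M i))
  ... | inj₂ i , refl =
    trans (cong (g ⟨$⟩ʳ_) (proj₂ (hx i))) (proj₂ (inStab-swapsMatching-commute x hx g g∈M i))

lemma6p6 : (n k : ℕ) (Γ : SimpleGraph n) (α β : Fin (suc (suc k)) → Fin n) →
    Connected Γ →
    IsPerfectMatching Γ α β →
    TwoTransitiveOnEdges Γ α β →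
    InducedIsoC4 Γ (α zero ∷ β zero ∷ α (suc zero) ∷ β (suc zero) ∷ []) →
    (x : Permutation′ n) →
    ((i : Fin (suc (suc k))) → (x ⟨$⟩ʳ α i ≡ β i) × (x ⟨$⟩ʳ β i ≡ α i)) →
    InStab Γ α β x ×
      ((g : Permutation′ n) → InStab Γ α β g →
        (v : Fin n) → g ⟨$⟩ʳ (x ⟨$⟩ʳ v) ≡ x ⟨$⟩ʳ (g ⟨$⟩ʳ v))
lemma6p6 n k Γ α β _ pm tt iso x hx =
  swapsMatching-inStab Γ α β pm everyPair x hx , swapsMatching-central Γ α β pm x hx
  where
  firstPair : SwapInvariant Γ (α zero) (β zero) (α (suc zero)) (β (suc zero))
  firstPair = induced-C4-swapInvariant Γ iso
    (here refl) (there (here refl)) (there (there (here refl))) (there (there (there (here refl))))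
    (proj₁ pm zero) (proj₁ pm (suc zero))

  everyPair : ∀ i j → SwapInvariant Γ (α i) (β i) (α j) (β j)
  everyPair = twoTransitive-swapInvariant Γ α β tt (λ ()) firstPair
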